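{- Let $d\ge 2$ and let $G$ be a graph obtained from the complete graph $K_d$ by an arbitrary sequence of edge subdivisions (each edge may be subdivided any number of times, including zero). Then the twin-width of $G$ is at most $d-1$.
   Context: Twin-width: a trigraph has black and red edges; contracting two (not necessarily adjacent) vertices $u,v$ replaces them by a new vertex $w$ where, for every other vertex $x$, $wx$ is black if $ux$ and $vx$ are both black edges, absent if neither $ux$ nor $vx$ is an edge (of either colour), and red otherwise. The twin-width of a graph $G$ is the minimum $d$ such that $G$ can be contracted to a single vertex by a sequence of contractions in which every intermediate trigraph has maximum red degree at most $d$. -}

module Defs where

open import Data.Nat using (ℕ; zero; suc; _≤_; _∸_)
open import Data.Bool using (Bool; true; false; _∧_; _∨_; not; if_then_else_)
open import Data.Fin using (Fin; zero; suc; punchIn; _≟_)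
open import Data.List using (map; allFin)
open import Data.Nat.ListAction using (sum)
open import Data.Product using (Σ)
open import Relation.Nullary using (does; ¬_)
open import Relation.Binary.PropositionalEquality using (_≡_)
open import Function.Bundles using (_↔_; Inverse)

Graph : ℕ → Set
Graph n = Fin n → Fin n → Bool

data Colour : Set where
  none black red : Colour

Trigraph : ℕ → Set
Trigraph n = Fin n → Fin n → Colour

toTrigraph : ∀ {n} → Graph n → Trigraph n
toTrigraph G i j = if G i j then black else none

-- colour of wx from colours of ux and vx
merge : Colour → Colour → Colour
merge black black = black
merge none  none  = none
merge _     _     = red

-- Contract u and v (u ≢ v) in a trigraph on Fin (suc n).  The vertex v is
-- removed (the remaining vertices are re-indexed by punchIn v) and the
-- vertex u plays the role of the new vertex w.
contract : ∀ {n} → Trigraph (suc n) → Fin (suc n) → Fin (suc n) → Trigraph n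
contract T u v i j =
  if does (punchIn v i ≟ u)
  then (if does (punchIn v j ≟ u) then none
        else merge (T u (punchIn v j)) (T v (punchIn v j)))
  else (if does (punchIn v j ≟ u)
        then merge (T (punchIn v i) u) (T (punchIn v i) v)
        else T (punchIn v i) (punchIn v j))

isRed : Colour → Bool
isRed red = true
isRed _   = false

redDeg : ∀ {n} → Trigraph n → Fin n → ℕ
redDeg {n} T i =
  sum (map (λ j → if not (does (j ≟ i)) ∧ isRed (T i j) then 1 else 0) (allFin n))

MaxRedDeg≤ : ∀ {n} → ℕ → Trigraph n → Set
MaxRedDeg≤ k T = ∀ i → redDeg T i ≤ k

data Contractible (k : ℕ) : (n : ℕ) → Trigraph n → Set where
  done : (T : Trigraph 1) → MaxRedDeg≤ k T → Contractible k 1 T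
  step : ∀ {n} (T : Trigraph (suc (suc n))) → MaxRedDeg≤ k T →
         (u v : Fin (suc (suc n))) → ¬ (u ≡ v) →
         Contractible k (suc n) (contract T u v) →
         Contractible k (suc (suc n)) T

TwwAtMost : ∀ {n} → ℕ → Graph n → Set
TwwAtMost {n} k G = Contractible k n (toTrigraph G)

complete : (d : ℕ) → Graph d
complete d i j = not (does (i ≟ j))

-- Subdivide the edge ab of G: the new vertex is zero, old vertex i is suc i.
subdivide : ∀ {n} → Graph n → Fin n → Fin n → Graph (suc n)
subdivide G a b zero    zero    = false
subdivide G a b zero    (suc j) = does (j ≟ a) ∨ does (j ≟ b)
subdivide G a b (suc i) zero    = does (i ≟ a) ∨ does (i ≟ b)
subdivide G a b (suc i) (suc j) =
  G i j ∧ not ((does (i ≟ a) ∧ does (j ≟ b)) ∨ (does (i ≟ b) ∧ does (j ≟ a)))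

Iso : ∀ {n} → Graph n → Graph n → Set
Iso {n} G H = Σ (Fin n ↔ Fin n) λ σ →
  ∀ i j → H (Inverse.to σ i) (Inverse.to σ j) ≡ G i j

data SubdivOfK (d : ℕ) : (n : ℕ) → Graph n → Set where
  base : SubdivOfK d d (complete d)
  sub  : ∀ {n} {G : Graph n} (a b : Fin n) → G a b ≡ true →
         SubdivOfK d n G → SubdivOfK d (suc n) (subdivide G a b)
  iso  : ∀ {n} {G H : Graph n} → SubdivOfK d n G → Iso G H → SubdivOfK d n H

-- Red degree is bounded by degree in the underlying graph (black and red edges together).
-- For d = 2 the graph is a path.  Contracting its lowest vertex into the next one creates red
-- edges only at the new lowest vertex, which has a single neighbour, so red degree stays ≤ 1.
-- For d ≥ 3, degrees are at most d − 1 and only the d original vertices can have degree ≥ 3.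
-- While more than d vertices remain, two vertices share an original label, so some vertex b
-- has degree ≤ 2; contracting b into a neighbour (anywhere if b is isolated) raises no degree
-- and preserves the invariant.  Once at most d vertices remain, all degrees are ≤ d − 1.

module Submission where

open import Data.Bool using (Bool; true; false; _∧_; _∨_; not; if_then_else_)
import Data.Bool.Properties as Bool
open import Data.Bool.Properties using (¬-not; ∨-identityʳ; ∧-identityʳ; ∧-zeroʳ; ∨-comm; ∧-comm)
open import Data.Empty using (⊥-elim)
open import Data.Fin using (Fin; zero; suc; toℕ; punchIn; _≟_)
open import Data.Fin.Permutation as Perm
  using (Permutation; _⟨$⟩ʳ_; _⟨$⟩ˡ_; inverseˡ; inverseʳ; remove; punchIn-permute)
open import Data.Fin.Properties
  using (toℕ-injective; suc-injective; punchInᵢ≢i; punchIn-punchOut; punchIn-injective; pigeonhole; any?; <⇒≢)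
open import Data.List using (map; allFin; tabulate)
open import Data.Nat using (ℕ; zero; suc; _+_; _≤_; _<_; _∸_; z≤n; s≤s; _≤?_)
open import Data.Nat.ListAction using (sum)
import Data.Nat.Properties as ℕ
open import Data.Nat.Properties
  using (≤-refl; ≤-trans; ≤-reflexive; ≤-antisym; ≤-pred; ≰⇒>; ≮⇒≥; 1+n≢n; 1+n≰n; n≤1+n;
         +-mono-≤; +-monoʳ-≤; +-comm; +-cancelˡ-≤; +-commutativeSemigroup; module ≤-Reasoning)
open import Data.Product using (∃; _×_; _,_; proj₁; proj₂)
import Data.Sum
open import Data.Sum using (_⊎_; inj₁; inj₂)
open import Function using (_∘_; id)
open import Function.Bundles using (mk⇔)
open import Relation.Nullary using (Dec; does; yes; no; ¬_)
open import Relation.Nullary.Decidable using (dec-true; dec-false; does-⇔)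
open import Relation.Binary.PropositionalEquality

open import Defs

open import Algebra.Properties.CommutativeSemigroup +-commutativeSemigroup using (interchange; x∙yz≈y∙xz)

does-true⇒ : ∀ {A : Set} (a? : Dec A) → does a? ≡ true → A
does-true⇒ (yes a) _ = a

∨-true : ∀ x {y} → (x ∨ y) ≡ true → x ≡ true ⊎ y ≡ true
∨-true true  _ = inj₁ refl
∨-true false y = inj₂ y

fromBool : Bool → ℕ
fromBool b = if b then 1 else 0

count : ∀ {n} → (Fin n → Bool) → ℕ
count {zero}  p = 0
count {suc n} p = fromBool (p zero) + count (p ∘ suc)

sum-tabulate≡count : ∀ {A : Set} {n} (g : Fin n → A) (p : A → Bool) →
  sum (map (λ x → if p x then 1 else 0) (tabulate g)) ≡ count (p ∘ g)
sum-tabulate≡count {n = zero}  g p = refl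
sum-tabulate≡count {n = suc n} g p = cong (fromBool (p (g zero)) +_) (sum-tabulate≡count (g ∘ suc) p)

sum-allFin≡count : ∀ {n} (p : Fin n → Bool) →
  sum (map (λ j → if p j then 1 else 0) (allFin n)) ≡ count p
sum-allFin≡count = sum-tabulate≡count id

count-cong : ∀ {n} {p q : Fin n → Bool} → (∀ j → p j ≡ q j) → count p ≡ count q
count-cong {zero}  p≗q = refl
count-cong {suc n} p≗q = cong₂ _+_ (cong fromBool (p≗q zero)) (count-cong (p≗q ∘ suc))

count-mono : ∀ {n} {p q : Fin n → Bool} → (∀ j → p j ≡ true → q j ≡ true) → count p ≤ count q
count-mono {zero}  p⇒q = z≤n
count-mono {suc n} p⇒q = +-mono-≤ (fromBool-mono (p⇒q zero)) (count-mono (p⇒q ∘ suc))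
  where
  fromBool-mono : ∀ {a b} → (a ≡ true → b ≡ true) → fromBool a ≤ fromBool b
  fromBool-mono {false} _   = z≤n
  fromBool-mono {true}  a⇒b rewrite a⇒b refl = ≤-refl

count-∨ : ∀ {n} (p q : Fin n → Bool) → count (λ j → p j ∨ q j) ≤ count p + count q
count-∨ {zero}  p q = z≤n
count-∨ {suc n} p q = ≤-trans
  (+-mono-≤ (fromBool-∨ (p zero) (q zero)) (count-∨ (p ∘ suc) (q ∘ suc)))
  (≤-reflexive (interchange (fromBool (p zero)) (fromBool (q zero)) (count (p ∘ suc)) (count (q ∘ suc))))
  where
  fromBool-∨ : ∀ a b → fromBool (a ∨ b) ≤ fromBool a + fromBool b
  fromBool-∨ true  b = s≤s z≤n
  fromBool-∨ false b = ≤-refl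

count≤n : ∀ {n} (p : Fin n → Bool) → count p ≤ n
count≤n {zero}  p = z≤n
count≤n {suc n} p = +-mono-≤ (fromBool≤1 (p zero)) (count≤n (p ∘ suc))
  where
  fromBool≤1 : ∀ b → fromBool b ≤ 1
  fromBool≤1 true  = ≤-refl
  fromBool≤1 false = z≤n

count-false : ∀ {n} (p : Fin n → Bool) → (∀ j → p j ≡ false) → count p ≡ 0
count-false {zero}  p p≗false = refl
count-false {suc n} p p≗false rewrite p≗false zero = count-false (p ∘ suc) (p≗false ∘ suc)

count-punchIn : ∀ {n} (v : Fin (suc n)) (p : Fin (suc n) → Bool) →
  count p ≡ fromBool (p v) + count (p ∘ punchIn v)
count-punchIn zero p = refl
count-punchIn {suc n} (suc v) p = begin
  fromBool (p zero) + count (p ∘ suc)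
    ≡⟨ cong (fromBool (p zero) +_) (count-punchIn v (p ∘ suc)) ⟩
  fromBool (p zero) + (fromBool (p (suc v)) + count (p ∘ suc ∘ punchIn v))
    ≡⟨ x∙yz≈y∙xz (fromBool (p zero)) (fromBool (p (suc v))) _ ⟩
  fromBool (p (suc v)) + (fromBool (p zero) + count (p ∘ suc ∘ punchIn v)) ∎
  where open ≡-Reasoning

count-remove : ∀ {n} (i : Fin n) (p : Fin n → Bool) →
  count p ≡ fromBool (p i) + count (λ j → not (does (j ≟ i)) ∧ p j)
count-remove {suc n} i p = begin
  count p
    ≡⟨ count-punchIn i p ⟩
  fromBool (p i) + count (p ∘ punchIn i)
    ≡⟨ cong (fromBool (p i) +_) (count-cong λ j → cong (λ b → not b ∧ p (punchIn i j))
                                   (sym (dec-false (punchIn i j ≟ i) (punchInᵢ≢i i j)))) ⟩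
  fromBool (p i) + count (p′ ∘ punchIn i)
    ≡⟨ cong (λ b → fromBool (p i) + (fromBool (not b ∧ p i) + count (p′ ∘ punchIn i)))
            (dec-true (i ≟ i) refl) ⟨
  fromBool (p i) + (fromBool (p′ i) + count (p′ ∘ punchIn i))
    ≡⟨ cong (fromBool (p i) +_) (count-punchIn i p′) ⟨
  fromBool (p i) + count p′ ∎
  where
  open ≡-Reasoning
  p′ : Fin (suc n) → Bool
  p′ j = not (does (j ≟ i)) ∧ p j

count-≤1 : ∀ {n} (p : Fin n → Bool) → (∀ j k → p j ≡ true → p k ≡ true → j ≡ k) → count p ≤ 1
count-≤1 {zero}  p unique = z≤n
count-≤1 {suc n} p unique with p zero in p0
... | true  = ≤-reflexive (cong suc (count-false (p ∘ suc) rest-false))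
  where
  rest-false : ∀ j → p (suc j) ≡ false
  rest-false j with p (suc j) in pj
  ... | true with () ← unique zero (suc j) p0 pj
  ... | false = refl
... | false = count-≤1 (p ∘ suc) (λ j k pj pk → suc-injective (unique (suc j) (suc k) pj pk))

count-permute : ∀ {n} (π : Permutation n n) (p : Fin n → Bool) → count (p ∘ (π ⟨$⟩ʳ_)) ≡ count p
count-permute {zero}  π p = refl
count-permute {suc n} π p = begin
  fromBool (p (π ⟨$⟩ʳ zero)) + count (p ∘ (π ⟨$⟩ʳ_) ∘ suc)
    ≡⟨ cong (fromBool (p (π ⟨$⟩ʳ zero)) +_) (count-cong λ j → cong p (punchIn-permute π zero j)) ⟩
  fromBool (p (π ⟨$⟩ʳ zero)) + count (p ∘ punchIn (π ⟨$⟩ʳ zero) ∘ (remove zero π ⟨$⟩ʳ_))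
    ≡⟨ cong (fromBool (p (π ⟨$⟩ʳ zero)) +_) (count-permute (remove zero π) _) ⟩
  fromBool (p (π ⟨$⟩ʳ zero)) + count (p ∘ punchIn (π ⟨$⟩ʳ zero))
    ≡⟨ count-punchIn (π ⟨$⟩ʳ zero) p ⟨
  count p ∎
  where open ≡-Reasoning

count-≟ : ∀ {n m} {g : Fin n → Fin m} → (∀ j k → g j ≡ g k → j ≡ k) →
  ∀ x → count (λ j → does (g j ≟ x)) ≤ 1
count-≟ {g = g} g-injective x = count-≤1 _ λ j k gj≡x gk≡x →
  g-injective j k (trans (does-true⇒ (g j ≟ x) gj≡x) (sym (does-true⇒ (g k ≟ x) gk≡x)))

count-≟∧ : ∀ {n m} {g : Fin n → Fin m} → (∀ j k → g j ≡ g k → j ≡ k) →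
  ∀ x c → count (λ j → does (g j ≟ x) ∧ c) ≤ fromBool c
count-≟∧ {g = g} g-injective x false = ≤-reflexive (count-false _ λ j → ∧-zeroʳ (does (g j ≟ x)))
count-≟∧ {g = g} g-injective x true  =
  subst (_≤ 1) (count-cong λ j → sym (∧-identityʳ (does (g j ≟ x)))) (count-≟ g-injective x)

isEdge : Colour → Bool
isEdge none = false
isEdge _    = true

underlying : ∀ {n} → Trigraph n → Graph n
underlying T i j = isEdge (T i j)

isNeighbour : ∀ {n} → Graph n → Fin n → Fin n → Bool
isNeighbour G i j = not (does (j ≟ i)) ∧ G i j

degree : ∀ {n} → Graph n → Fin n → ℕ
degree G i = count (isNeighbour G i)

Undirected : ∀ {n} → Graph n → Set
Undirected G = ∀ i j → G i j ≡ G j i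

Loopless : ∀ {n} → Graph n → Set
Loopless G = ∀ i → G i i ≡ false

isNeighbour⇒ : ∀ {n} (G : Graph n) {i j} → isNeighbour G i j ≡ true → ¬ j ≡ i × G i j ≡ true
isNeighbour⇒ G {i} {j} nbr with j ≟ i
... | no j≢i = j≢i , nbr

⇒isNeighbour : ∀ {n} (G : Graph n) {i j} → ¬ j ≡ i → G i j ≡ true → isNeighbour G i j ≡ true
⇒isNeighbour G {i} {j} j≢i edge rewrite dec-false (j ≟ i) j≢i = edge

isRedNeighbour : ∀ {n} → Trigraph n → Fin n → Fin n → Bool
isRedNeighbour T i j = not (does (j ≟ i)) ∧ isRed (T i j)

redDeg≡count : ∀ {n} (T : Trigraph n) i → redDeg T i ≡ count (isRedNeighbour T i)
redDeg≡count T i = sum-allFin≡count (isRedNeighbour T i)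

redDeg≤degree : ∀ {n} (T : Trigraph n) i → redDeg T i ≤ degree (underlying T) i
redDeg≤degree T i = ≤-trans (≤-reflexive (redDeg≡count T i)) (count-mono red⇒edge)
  where
  red⇒edge : ∀ j → isRedNeighbour T i j ≡ true → isNeighbour (underlying T) i j ≡ true
  red⇒edge j _ with does (j ≟ i) | T i j
  ... | false | red = refl

degree≤n : ∀ {n} (G : Graph (suc n)) i → degree G i ≤ n
degree≤n G i = ≤-trans (≤-reflexive degree≡) (count≤n (isNeighbour G i ∘ punchIn i))
  where
  degree≡ : degree G i ≡ count (isNeighbour G i ∘ punchIn i)
  degree≡ = trans (count-punchIn i (isNeighbour G i))
    (cong (λ x → fromBool (not x ∧ G i i) + count (isNeighbour G i ∘ punchIn i)) (dec-true (i ≟ i) refl))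

degree-without : ∀ {n} (G : Graph n) i t → isNeighbour G i t ≡ true → (p : Fin n → Bool) →
  (∀ j → p j ≡ true → isNeighbour G i j ≡ true × ¬ j ≡ t) → suc (count p) ≤ degree G i
degree-without {n} G i t nbr p p⇒ = begin
  suc (count p)                                ≤⟨ s≤s (count-mono p⇒′) ⟩
  suc (count others)                           ≡⟨ cong (λ x → fromBool x + count others) nbr ⟨
  fromBool (isNeighbour G i t) + count others  ≡⟨ count-remove t (isNeighbour G i) ⟨
  degree G i                                   ∎
  where
  open ≤-Reasoning
  others : Fin n → Bool
  others j = not (does (j ≟ t)) ∧ isNeighbour G i j
  p⇒′ : ∀ j → p j ≡ true → others j ≡ true
  p⇒′ j pj with p⇒ j pj
  ... | nbr-j , j≢t rewrite dec-false (j ≟ t) j≢t = nbr-j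

contractGraph : ∀ {n} → Graph (suc n) → Fin (suc n) → Fin (suc n) → Graph n
contractGraph G u v i j =
  if does (punchIn v i ≟ u)
  then (if does (punchIn v j ≟ u) then false else G u (punchIn v j) ∨ G v (punchIn v j))
  else (if does (punchIn v j ≟ u)
        then G (punchIn v i) u ∨ G (punchIn v i) v
        else G (punchIn v i) (punchIn v j))

isEdge-merge : ∀ x y → isEdge (merge x y) ≡ isEdge x ∨ isEdge y
isEdge-merge none  none  = refl
isEdge-merge none  black = refl
isEdge-merge none  red   = refl
isEdge-merge black none  = refl
isEdge-merge black black = refl
isEdge-merge black red   = refl
isEdge-merge red   _     = refl

underlying-contract : ∀ {n} (T : Trigraph (suc n)) u v i j →
  underlying (contract T u v) i j ≡ contractGraph (underlying T) u v i j
underlying-contract T u v i j with does (punchIn v i ≟ u) | does (punchIn v j ≟ u)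
... | true  | true  = refl
... | true  | false = isEdge-merge (T u (punchIn v j)) (T v (punchIn v j))
... | false | true  = isEdge-merge (T (punchIn v i) u) (T (punchIn v i) v)
... | false | false = refl

underlying-toTrigraph : ∀ {n} (G : Graph n) i j → underlying (toTrigraph G) i j ≡ G i j
underlying-toTrigraph G i j with G i j
... | true  = refl
... | false = refl

contractGraph-undirected : ∀ {n} {G : Graph (suc n)} → Undirected G → ∀ u v → Undirected (contractGraph G u v)
contractGraph-undirected undirected u v i j with does (punchIn v i ≟ u) | does (punchIn v j ≟ u)
... | true  | true  = refl
... | true  | false = cong₂ _∨_ (undirected u _) (undirected v _)
... | false | true  = cong₂ _∨_ (undirected _ u) (undirected _ v)
... | false | false = undirected _ _

contractGraph-loopless : ∀ {n} {G : Graph (suc n)} → Loopless G → ∀ u v → Loopless (contractGraph G u v)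
contractGraph-loopless loopless u v i with does (punchIn v i ≟ u)
... | true  = refl
... | false = loopless (punchIn v i)

punchIn≟-does : ∀ {n} (b : Fin (suc n)) {i : Fin n} {a : Fin (suc n)} → punchIn b i ≡ a →
  ∀ j → does (punchIn b j ≟ a) ≡ does (j ≟ i)
punchIn≟-does b {i} refl j =
  does-⇔ (mk⇔ (punchIn-injective b j i) (cong (punchIn b))) (punchIn b j ≟ punchIn b i) (j ≟ i)

-- If b is isolated, or adjacent to a with at most one other neighbour, then the merged vertex
-- gains at most the one neighbour it loses (b itself), and any other vertex trades b for a.
module _ {n} {G : Graph (suc n)} (undirected : Undirected G) {a b : Fin (suc n)} (a≢b : ¬ a ≡ b) where

  degree-contract-merged : degree G b ≤ fromBool (G b a) + fromBool (G b a) →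
    ∀ i → punchIn b i ≡ a → degree (contractGraph G a b) i ≤ degree G a
  degree-contract-merged degree-b≤ i pi≡a = begin
    degree (contractGraph G a b) i  ≡⟨ count-cong merged-row ⟩
    count (λ j → P j ∨ Q j)         ≤⟨ count-∨ P Q ⟩
    count P + count Q               ≤⟨ +-monoʳ-≤ (count P) count-Q≤e ⟩
    count P + e                     ≡⟨ +-comm (count P) e ⟩
    e + count P                     ≡⟨ degree-a ⟨
    degree G a                      ∎
    where
    open ≤-Reasoning
    e : ℕ
    e = fromBool (G b a)
    P Q : Fin n → Bool
    P j = not (does (j ≟ i)) ∧ G a (punchIn b j)
    Q j = not (does (j ≟ i)) ∧ G b (punchIn b j)
    merged-row : ∀ j → (not (does (j ≟ i)) ∧ contractGraph G a b i j) ≡ (P j ∨ Q j)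
    merged-row j rewrite dec-true (punchIn b i ≟ a) pi≡a | punchIn≟-does b pi≡a j with does (j ≟ i)
    ... | true  = refl
    ... | false = refl
    degree-a : degree G a ≡ e + count P
    degree-a = trans (count-punchIn b (isNeighbour G a)) (cong₂ _+_
      (cong₂ (λ x y → fromBool (not x ∧ y)) (dec-false (b ≟ a) (a≢b ∘ sym)) (undirected a b))
      (count-cong λ j → cong (λ x → not x ∧ G a (punchIn b j)) (punchIn≟-does b pi≡a j)))
    degree-b : degree G b ≡ e + count Q
    degree-b = begin-equality
      degree G b
        ≡⟨ count-punchIn b (isNeighbour G b) ⟩
      fromBool (not (does (b ≟ b)) ∧ G b b) + count (λ j → not (does (punchIn b j ≟ b)) ∧ G b (punchIn b j))
        ≡⟨ cong₂ (λ x y → fromBool (not x ∧ G b b) + y) (dec-true (b ≟ b) refl)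
                 (count-cong λ j → cong (λ x → not x ∧ G b (punchIn b j))
                                        (dec-false (punchIn b j ≟ b) (punchInᵢ≢i b j))) ⟩
      count (λ j → G b (punchIn b j))
        ≡⟨ count-remove i (λ j → G b (punchIn b j)) ⟩
      fromBool (G b (punchIn b i)) + count Q
        ≡⟨ cong (λ x → fromBool (G b x) + count Q) pi≡a ⟩
      e + count Q ∎
    count-Q≤e : count Q ≤ e
    count-Q≤e = +-cancelˡ-≤ e (count Q) e (subst (_≤ e + e) degree-b degree-b≤)

  degree-contract-other : ∀ i → ¬ punchIn b i ≡ a → degree (contractGraph G a b) i ≤ degree G (punchIn b i)
  degree-contract-other i pi≢a = begin
    degree (contractGraph G a b) i  ≤⟨ count-mono row⇒ ⟩
    count (λ j → P j ∨ Q j)         ≤⟨ count-∨ P Q ⟩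
    count P + count Q               ≤⟨ +-monoʳ-≤ (count P) (count-≟∧ (punchIn-injective b) a (G pi b)) ⟩
    count P + fromBool (G pi b)     ≡⟨ +-comm (count P) _ ⟩
    fromBool (G pi b) + count P     ≡⟨ degree-pi ⟨
    degree G pi                     ∎
    where
    open ≤-Reasoning
    pi : Fin (suc n)
    pi = punchIn b i
    P Q : Fin n → Bool
    P j = not (does (j ≟ i)) ∧ G pi (punchIn b j)
    Q j = does (punchIn b j ≟ a) ∧ G pi b
    row⇒ : ∀ j → (not (does (j ≟ i)) ∧ contractGraph G a b i j) ≡ true → (P j ∨ Q j) ≡ true
    row⇒ j edge rewrite dec-false (pi ≟ a) pi≢a with does (j ≟ i) | punchIn b j ≟ a
    ... | false | yes refl = edge
    ... | false | no _     = trans (∨-identityʳ _) edge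
    degree-pi : degree G pi ≡ fromBool (G pi b) + count P
    degree-pi = trans (count-punchIn b (isNeighbour G pi)) (cong₂ _+_
      (cong (λ x → fromBool (not x ∧ G pi b)) (dec-false (b ≟ pi) (punchInᵢ≢i b i ∘ sym)))
      (count-cong λ j → cong (λ x → not x ∧ G pi (punchIn b j)) (punchIn≟-does b refl j)))

  degree-contract≤ : degree G b ≤ fromBool (G b a) + fromBool (G b a) →
    ∀ i → degree (contractGraph G a b) i ≤ degree G (punchIn b i)
  degree-contract≤ degree-b≤ i = by-cases (punchIn b i ≟ a)
    where
    by-cases : Dec (punchIn b i ≡ a) → degree (contractGraph G a b) i ≤ degree G (punchIn b i)
    by-cases (yes pi≡a) = subst (degree (contractGraph G a b) i ≤_) (cong (degree G) (sym pi≡a))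
                                (degree-contract-merged degree-b≤ i pi≡a)
    by-cases (no pi≢a)  = degree-contract-other i pi≢a

≗⇒Iso : ∀ {n} {G H : Graph n} → (∀ i j → H i j ≡ G i j) → Iso G H
≗⇒Iso H≗G = Perm.id , H≗G

module Iso-properties {n} {G H : Graph n} (G≅H : Iso G H) where
  private
    σ : Permutation n n
    σ = proj₁ G≅H

  Iso-adjacency : ∀ x y → H x y ≡ G (σ ⟨$⟩ˡ x) (σ ⟨$⟩ˡ y)
  Iso-adjacency x y = trans (sym (cong₂ H (inverseʳ σ) (inverseʳ σ))) (proj₂ G≅H _ _)

  Iso-injective : ∀ x y → σ ⟨$⟩ˡ x ≡ σ ⟨$⟩ˡ y → x ≡ y
  Iso-injective x y e = trans (sym (inverseʳ σ)) (trans (cong (σ ⟨$⟩ʳ_) e) (inverseʳ σ))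

  Iso-degree : ∀ x → degree H x ≡ degree G (σ ⟨$⟩ˡ x)
  Iso-degree x = trans (sym (count-permute σ (isNeighbour H x))) (count-cong λ k →
    cong₂ (λ u v → not u ∧ v) (does-⟨$⟩ʳ k) (trans (Iso-adjacency x _) (cong (G _) (inverseˡ σ))))
    where
    does-⟨$⟩ʳ : ∀ k → does ((σ ⟨$⟩ʳ k) ≟ x) ≡ does (k ≟ (σ ⟨$⟩ˡ x))
    does-⟨$⟩ʳ k = does-⇔ (mk⇔ (λ e → trans (sym (inverseˡ σ)) (cong (σ ⟨$⟩ˡ_) e))
                               (λ e → trans (cong (σ ⟨$⟩ʳ_) e) (inverseʳ σ)))
                         ((σ ⟨$⟩ʳ k) ≟ x) (k ≟ (σ ⟨$⟩ˡ x))

module _ {n} (G : Graph n) (a b : Fin n) where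

  subdivide-new : ∀ j → subdivide G a b zero (suc j) ≡ true → j ≡ a ⊎ j ≡ b
  subdivide-new j edge with j ≟ a | j ≟ b
  ... | yes j≡a | _       = inj₁ j≡a
  ... | no _    | yes j≡b = inj₂ j≡b

  subdivide-old : ∀ i j → subdivide G a b (suc i) (suc j) ≡ true →
    G i j ≡ true × ¬ (i ≡ a × j ≡ b) × ¬ (i ≡ b × j ≡ a)
  subdivide-old i j edge with G i j | i ≟ a | j ≟ b | i ≟ b | j ≟ a
  ... | true | no i≢a  | _       | no i≢b  | _       = refl , i≢a ∘ proj₁ , i≢b ∘ proj₁
  ... | true | no i≢a  | _       | yes _   | no j≢a  = refl , i≢a ∘ proj₁ , j≢a ∘ proj₂
  ... | true | yes _   | no j≢b  | no i≢b  | _       = refl , j≢b ∘ proj₂ , i≢b ∘ proj₁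
  ... | true | yes _   | no j≢b  | yes _   | no j≢a  = refl , j≢b ∘ proj₂ , j≢a ∘ proj₂

-- d ≥ 3: few branch vertices

-- Vertices of degree ≥ 3 are branch vertices of a subdivided K_(k+1), so they have distinct
-- labels in Fin (suc k).
record FewBranchVertices (k : ℕ) {n} (G : Graph n) : Set where
  field
    undirected      : Undirected G
    loopless        : Loopless G
    degree≤         : ∀ i → degree G i ≤ k
    label           : Fin n → Fin (suc k)
    label-injective : ∀ i j → label i ≡ label j → 3 ≤ degree G i → 3 ≤ degree G j → i ≡ j

complete-fewBranch : ∀ k → FewBranchVertices k (complete (suc k))
complete-fewBranch k = record
  { undirected      = λ i j → cong not (does-⇔ (mk⇔ sym sym) (i ≟ j) (j ≟ i))
  ; loopless        = λ i → cong not (dec-true (i ≟ i) refl)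
  ; degree≤         = degree≤n (complete (suc k))
  ; label           = id
  ; label-injective = λ i j li≡lj _ _ → li≡lj
  }

Iso-fewBranch : ∀ {k n} {G H : Graph n} → FewBranchVertices k G → Iso G H → FewBranchVertices k H
Iso-fewBranch {k} {G = G} {H} F G≅H = record
  { undirected      = λ x y → trans (Iso-adjacency x y) (trans (undirected _ _) (sym (Iso-adjacency y x)))
  ; loopless        = λ x → trans (Iso-adjacency x x) (loopless _)
  ; degree≤         = λ x → subst (_≤ k) (sym (Iso-degree x)) (degree≤ _)
  ; label           = label ∘ (proj₁ G≅H ⟨$⟩ˡ_)
  ; label-injective = λ x y lx≡ly 3≤x 3≤y → Iso-injective x y (label-injective _ _ lx≡ly
                        (subst (3 ≤_) (Iso-degree x) 3≤x) (subst (3 ≤_) (Iso-degree y) 3≤y))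
  }
  where
  open FewBranchVertices F
  open Iso-properties {G = G} {H} G≅H

module _ {n} {G : Graph n} {a b : Fin n} (edge-ab : G a b ≡ true)
         (undirected : Undirected G) (loopless : Loopless G) where
  private
    S : Graph (suc n)
    S = subdivide G a b

  edge⇒≢ : ¬ a ≡ b
  edge⇒≢ refl with trans (sym edge-ab) (loopless a)
  ... | ()

  subdivide-undirected : Undirected S
  subdivide-undirected zero    zero    = refl
  subdivide-undirected zero    (suc j) = refl
  subdivide-undirected (suc i) zero    = refl
  subdivide-undirected (suc i) (suc j) = cong₂ (λ x y → x ∧ not y) (undirected i j)
    (trans (∨-comm (does (i ≟ a) ∧ does (j ≟ b)) _)
           (cong₂ _∨_ (∧-comm (does (i ≟ b)) _) (∧-comm (does (i ≟ a)) _)))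

  subdivide-loopless : Loopless S
  subdivide-loopless zero = refl
  subdivide-loopless (suc i) rewrite loopless i = refl

  degree-subdivide-new : degree S zero ≤ 2
  degree-subdivide-new = ≤-trans (count-∨ (λ j → does (j ≟ a)) (λ j → does (j ≟ b)))
    (+-mono-≤ (count-≟ {g = id} (λ _ _ → id) a) (count-≟ {g = id} (λ _ _ → id) b))

  degree-subdivide-old : ∀ i → degree S (suc i) ≤ degree G i
  degree-subdivide-old i = by-cases (i ≟ a) (i ≟ b)
    where
    p : Fin n → Bool
    p = isNeighbour S (suc i) ∘ suc
    p-edge : ∀ j → p j ≡ true → ¬ j ≡ i × G i j ≡ true × ¬ (i ≡ a × j ≡ b) × ¬ (i ≡ b × j ≡ a)
    p-edge j pj with isNeighbour⇒ S {suc i} {suc j} pj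
    ... | sj≢si , edge = sj≢si ∘ cong suc , subdivide-old G a b i j edge
    by-cases : Dec (i ≡ a) → Dec (i ≡ b) → degree S (suc i) ≤ degree G i
    by-cases (yes refl) _ =
      subst (_≤ degree G a) (sym (cong (λ x → fromBool (x ∨ does (a ≟ b)) + count p) (dec-true (a ≟ a) refl)))
        (degree-without G a b (⇒isNeighbour G (edge⇒≢ ∘ sym) edge-ab) p λ j pj →
          let j≢a , edge , not-ab , _ = p-edge j pj in ⇒isNeighbour G j≢a edge , λ j≡b → not-ab (refl , j≡b))
    by-cases (no i≢a) (yes refl) =
      subst (_≤ degree G b) (sym (cong₂ (λ x y → fromBool (x ∨ y) + count p)
                                        (dec-false (b ≟ a) i≢a) (dec-true (b ≟ b) refl)))
        (degree-without G b a (⇒isNeighbour G edge⇒≢ (trans (undirected b a) edge-ab)) p λ j pj →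
          let j≢b , edge , _ , not-ba = p-edge j pj in ⇒isNeighbour G j≢b edge , λ j≡a → not-ba (refl , j≡a))
    by-cases (no i≢a) (no i≢b) =
      subst (_≤ degree G i) (sym (cong₂ (λ x y → fromBool (x ∨ y) + count p)
                                        (dec-false (i ≟ a) i≢a) (dec-false (i ≟ b) i≢b)))
        (count-mono λ j pj → let j≢i , edge , _ = p-edge j pj in ⇒isNeighbour G j≢i edge)

subdivide-fewBranch : ∀ {k n} {G : Graph n} → 2 ≤ k → FewBranchVertices k G →
  ∀ {a b} → G a b ≡ true → FewBranchVertices k (subdivide G a b)
subdivide-fewBranch {k} {G = G} 2≤k F {a} {b} edge-ab = record
  { undirected      = subdivide-undirected edge-ab undirected loopless
  ; loopless        = subdivide-loopless edge-ab undirected loopless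
  ; degree≤         = λ { zero    → ≤-trans degree-new 2≤k
                        ; (suc i) → ≤-trans (degree-old i) (degree≤ i) }
  ; label           = label′
  ; label-injective = label-injective′
  }
  where
  open FewBranchVertices F
  degree-new : degree (subdivide G a b) zero ≤ 2
  degree-new = degree-subdivide-new edge-ab undirected loopless
  degree-old : ∀ i → degree (subdivide G a b) (suc i) ≤ degree G i
  degree-old = degree-subdivide-old edge-ab undirected loopless
  label′ : Fin (suc _) → Fin (suc k)
  label′ zero    = label a
  label′ (suc i) = label i
  new-not-branch : ¬ 3 ≤ degree (subdivide G a b) zero
  new-not-branch 3≤ with ≤-trans 3≤ degree-new
  ... | s≤s (s≤s ())
  label-injective′ : ∀ i j → label′ i ≡ label′ j →
    3 ≤ degree (subdivide G a b) i → 3 ≤ degree (subdivide G a b) j → i ≡ j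
  label-injective′ zero    _       _     3≤i _   = ⊥-elim (new-not-branch 3≤i)
  label-injective′ (suc i) zero    _     _   3≤j = ⊥-elim (new-not-branch 3≤j)
  label-injective′ (suc i) (suc j) li≡lj 3≤i 3≤j = cong suc
    (label-injective i j li≡lj (≤-trans 3≤i (degree-old i)) (≤-trans 3≤j (degree-old j)))

subdivision-fewBranch : ∀ {k n} {G : Graph n} → 2 ≤ k → SubdivOfK (suc k) n G → FewBranchVertices k G
subdivision-fewBranch {k} 2≤k base               = complete-fewBranch k
subdivision-fewBranch     2≤k (sub a b edge-ab G′) = subdivide-fewBranch 2≤k (subdivision-fewBranch 2≤k G′) edge-ab
subdivision-fewBranch     2≤k (iso G′ G′≅G)       = Iso-fewBranch (subdivision-fewBranch 2≤k G′) G′≅G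

contractGraph-fewBranch : ∀ {k n} {G : Graph (suc n)} → FewBranchVertices k G →
  ∀ {a b} → ¬ a ≡ b → degree G b ≤ fromBool (G b a) + fromBool (G b a) →
  FewBranchVertices k (contractGraph G a b)
contractGraph-fewBranch {G = G} F {a} {b} a≢b degree-b≤ = record
  { undirected      = contractGraph-undirected {G = G} undirected a b
  ; loopless        = contractGraph-loopless {G = G} loopless a b
  ; degree≤         = λ i → ≤-trans (shrinks i) (degree≤ (punchIn b i))
  ; label           = label ∘ punchIn b
  ; label-injective = λ i j li≡lj 3≤i 3≤j → punchIn-injective b i j
                        (label-injective _ _ li≡lj (≤-trans 3≤i (shrinks i)) (≤-trans 3≤j (shrinks j)))
  }
  where
  open FewBranchVertices F
  shrinks : ∀ i → degree (contractGraph G a b) i ≤ degree G (punchIn b i)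
  shrinks = degree-contract≤ undirected a≢b degree-b≤

low-degree-vertex : ∀ {k n} {G : Graph n} → FewBranchVertices k G → suc k < n → ∃ λ b → degree G b ≤ 2
low-degree-vertex {G = G} F k<n with pigeonhole k<n (FewBranchVertices.label F)
... | i , j , i<j , li≡lj with 3 ≤? degree G i | 3 ≤? degree G j
...   | no i-low | _        = i , ≤-pred (≰⇒> i-low)
...   | yes _    | no j-low = j , ≤-pred (≰⇒> j-low)
...   | yes 3≤i  | yes 3≤j  = ⊥-elim (<⇒≢ i<j (FewBranchVertices.label-injective F i j li≡lj 3≤i 3≤j))

absorbing-partner : ∀ {n} (G : Graph (suc (suc n))) b → degree G b ≤ 2 →
  ∃ λ a → ¬ a ≡ b × degree G b ≤ fromBool (G b a) + fromBool (G b a)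
absorbing-partner G b degree≤2 with any? (λ x → isNeighbour G b x Bool.≟ true)
... | yes (a , nbr) = let a≢b , edge = isNeighbour⇒ G nbr in
  a , a≢b , subst (λ x → degree G b ≤ fromBool x + fromBool x) (sym edge) degree≤2
... | no isolated = punchIn b zero , punchInᵢ≢i b zero ,
  ≤-trans (≤-reflexive (count-false (isNeighbour G b) λ x → ¬-not (isolated ∘ (x ,_)))) z≤n

maxRedDeg≤ : ∀ {k n} (T : Trigraph n) → (∀ i → degree (underlying T) i ≤ k) → MaxRedDeg≤ k T
maxRedDeg≤ T degree≤ i = ≤-trans (redDeg≤degree T i) (degree≤ i)

small-maxRedDeg≤ : ∀ {k n} (T : Trigraph (suc n)) → n ≤ k → MaxRedDeg≤ k T
small-maxRedDeg≤ T n≤k = maxRedDeg≤ T λ i → ≤-trans (degree≤n (underlying T) i) n≤k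

small-contractible : ∀ {k} n (T : Trigraph (suc n)) → n ≤ k → Contractible k (suc n) T
small-contractible zero    T n≤k = done T (small-maxRedDeg≤ T n≤k)
small-contractible (suc n) T n≤k = step T (small-maxRedDeg≤ T n≤k) zero (suc zero) (λ ())
  (small-contractible n _ (≤-trans (n≤1+n n) n≤k))

fewBranch-contractible : ∀ {k} n (T : Trigraph (suc n)) → FewBranchVertices k (underlying T) →
  Contractible k (suc n) T
fewBranch-contractible zero T F = done T (maxRedDeg≤ T (FewBranchVertices.degree≤ F))
fewBranch-contractible {k} (suc n) T F with suc n ≤? k
... | yes 1+n≤k = small-contractible (suc n) T 1+n≤k
... | no  1+n≰k =
  let b , degree-b≤2       = low-degree-vertex F (s≤s (≰⇒> 1+n≰k))
      a , a≢b , degree-b≤ = absorbing-partner (underlying T) b degree-b≤2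
      F′ = Iso-fewBranch (contractGraph-fewBranch F a≢b degree-b≤) (≗⇒Iso (underlying-contract T a b))
  in step T (maxRedDeg≤ T (FewBranchVertices.degree≤ F)) a b a≢b (fewBranch-contractible n (contract T a b) F′)

-- d = 2: paths

Consecutive : ℕ → ℕ → Set
Consecutive x y = y ≡ suc x ⊎ x ≡ suc y

Consecutive-sym : ∀ {x y} → Consecutive x y → Consecutive y x
Consecutive-sym (inj₁ y≡1+x) = inj₂ y≡1+x
Consecutive-sym (inj₂ x≡1+y) = inj₁ x≡1+y

record PathEmbedding {n} (G : Graph n) : Set where
  field
    height             : Fin n → ℕ
    height-injective   : ∀ i j → height i ≡ height j → i ≡ j
    height-consecutive : ∀ i j → G i j ≡ true → Consecutive (height i) (height j)

complete-pathEmbedding : PathEmbedding (complete 2)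
complete-pathEmbedding = record
  { height             = toℕ
  ; height-injective   = λ i j → toℕ-injective
  ; height-consecutive = consecutive
  }
  where
  consecutive : ∀ i j → complete 2 i j ≡ true → Consecutive (toℕ i) (toℕ j)
  consecutive zero       zero       ()
  consecutive zero       (suc zero) _ = inj₁ refl
  consecutive (suc zero) zero       _ = inj₂ refl
  consecutive (suc zero) (suc zero) ()

Iso-pathEmbedding : ∀ {n} {G H : Graph n} → PathEmbedding G → Iso G H → PathEmbedding H
Iso-pathEmbedding {G = G} {H} P G≅H = record
  { height             = height ∘ (proj₁ G≅H ⟨$⟩ˡ_)
  ; height-injective   = λ x y hx≡hy → Iso-injective x y (height-injective _ _ hx≡hy)
  ; height-consecutive = λ x y edge → height-consecutive _ _ (trans (sym (Iso-adjacency x y)) edge)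
  }
  where
  open PathEmbedding P
  open Iso-properties {G = G} {H} G≅H

shiftAbove : ℕ → ℕ → ℕ
shiftAbove c v with v ≤? c
... | yes _ = v
... | no  _ = suc v

module _ (c : ℕ) where

  shiftAbove-injective : ∀ x y → shiftAbove c x ≡ shiftAbove c y → x ≡ y
  shiftAbove-injective x y e with x ≤? c | y ≤? c
  ... | yes _   | yes _   = e
  ... | no  _   | no  _   = ℕ.suc-injective e
  ... | yes x≤c | no  y≰c = ⊥-elim (y≰c (≤-trans (n≤1+n y) (subst (_≤ c) e x≤c)))
  ... | no  x≰c | yes y≤c = ⊥-elim (x≰c (≤-trans (n≤1+n x) (subst (_≤ c) (sym e) y≤c)))

  shiftAbove≢1+c : ∀ x → ¬ shiftAbove c x ≡ suc c
  shiftAbove≢1+c x e with x ≤? c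
  ... | yes x≤c = 1+n≰n (subst (_≤ c) e x≤c)
  ... | no  x≰c = x≰c (≤-reflexive (ℕ.suc-injective e))

  shiftAbove-c : shiftAbove c c ≡ c
  shiftAbove-c with c ≤? c
  ... | yes _   = refl
  ... | no  c≰c = ⊥-elim (c≰c ≤-refl)

  shiftAbove-1+c : shiftAbove c (suc c) ≡ suc (suc c)
  shiftAbove-1+c with suc c ≤? c
  ... | yes 1+c≤c = ⊥-elim (1+n≰n 1+c≤c)
  ... | no  _     = refl

  shiftAbove-consecutive : ∀ x y → Consecutive x y → ¬ (x ≡ c × y ≡ suc c) → ¬ (x ≡ suc c × y ≡ c) →
    Consecutive (shiftAbove c x) (shiftAbove c y)
  shiftAbove-consecutive x y xy not-up not-down with x ≤? c | y ≤? c
  ... | yes _ | yes _ = xy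
  ... | no  _ | no  _ = Data.Sum.map (cong suc) (cong suc) xy
  shiftAbove-consecutive x y (inj₁ refl) not-up not-down | yes x≤c | no x≮c =
    let x≡c = ≤-antisym x≤c (≮⇒≥ x≮c) in ⊥-elim (not-up (x≡c , cong suc x≡c))
  shiftAbove-consecutive x y (inj₂ refl) not-up not-down | yes x≤c | no y≰c =
    ⊥-elim (y≰c (≤-trans (n≤1+n y) x≤c))
  shiftAbove-consecutive x y (inj₂ refl) not-up not-down | no y≮c | yes y≤c =
    let y≡c = ≤-antisym y≤c (≮⇒≥ y≮c) in ⊥-elim (not-down (cong suc y≡c , y≡c))
  shiftAbove-consecutive x y (inj₁ refl) not-up not-down | no x≰c | yes y≤c =
    ⊥-elim (x≰c (≤-trans (n≤1+n x) y≤c))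

subdivide-swap : ∀ {n} (G : Graph n) a b i j → subdivide G a b i j ≡ subdivide G b a i j
subdivide-swap G a b zero    zero    = refl
subdivide-swap G a b zero    (suc j) = ∨-comm (does (j ≟ a)) _
subdivide-swap G a b (suc i) zero    = ∨-comm (does (i ≟ a)) _
subdivide-swap G a b (suc i) (suc j) = cong (λ x → G i j ∧ not x) (∨-comm (does (i ≟ a) ∧ does (j ≟ b)) _)

module _ {n} {G : Graph n} (P : PathEmbedding G) where
  open PathEmbedding P

  subdivide-pathEmbedding-upward : ∀ {a b} → height b ≡ suc (height a) → PathEmbedding (subdivide G a b)
  subdivide-pathEmbedding-upward {a} {b} hb≡1+ha = record
    { height             = height′
    ; height-injective   = injective′
    ; height-consecutive = consecutive′
    }
    where
    c : ℕ
    c = height a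
    -- The new vertex sits at height c + 1; every height above c moves up by one.
    height′ : Fin (suc n) → ℕ
    height′ zero    = suc c
    height′ (suc i) = shiftAbove c (height i)
    injective′ : ∀ i j → height′ i ≡ height′ j → i ≡ j
    injective′ zero    zero    _ = refl
    injective′ zero    (suc j) e = ⊥-elim (shiftAbove≢1+c c (height j) (sym e))
    injective′ (suc i) zero    e = ⊥-elim (shiftAbove≢1+c c (height i) e)
    injective′ (suc i) (suc j) e = cong suc (height-injective i j (shiftAbove-injective c _ _ e))
    to-new : ∀ j → j ≡ a ⊎ j ≡ b → Consecutive (suc c) (shiftAbove c (height j))
    to-new j (inj₁ refl) = inj₂ (cong suc (sym (shiftAbove-c c)))
    to-new j (inj₂ refl) = inj₁ (trans (cong (shiftAbove c) hb≡1+ha) (shiftAbove-1+c c))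
    consecutive′ : ∀ i j → subdivide G a b i j ≡ true → Consecutive (height′ i) (height′ j)
    consecutive′ zero    zero    ()
    consecutive′ zero    (suc j) edge = to-new j (subdivide-new G a b j edge)
    consecutive′ (suc i) zero    edge = Consecutive-sym (to-new i (subdivide-new G a b i edge))
    consecutive′ (suc i) (suc j) edge =
      let edge′ , not-ab , not-ba = subdivide-old G a b i j edge in
      shiftAbove-consecutive c _ _ (height-consecutive i j edge′)
        (λ (hi≡c , hj≡1+c) → not-ab (height-injective i a hi≡c ,
                                      height-injective j b (trans hj≡1+c (sym hb≡1+ha))))
        (λ (hi≡1+c , hj≡c) → not-ba (height-injective i b (trans hi≡1+c (sym hb≡1+ha)) ,
                                      height-injective j a hj≡c))

  subdivide-pathEmbedding : ∀ {a b} → G a b ≡ true → PathEmbedding (subdivide G a b)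
  subdivide-pathEmbedding {a} {b} edge with height-consecutive a b edge
  ... | inj₁ hb≡1+ha = subdivide-pathEmbedding-upward hb≡1+ha
  ... | inj₂ ha≡1+hb = Iso-pathEmbedding (subdivide-pathEmbedding-upward ha≡1+hb) (≗⇒Iso (subdivide-swap G a b))

subdivision-pathEmbedding : ∀ {n} {G : Graph n} → SubdivOfK 2 n G → PathEmbedding G
subdivision-pathEmbedding base                 = complete-pathEmbedding
subdivision-pathEmbedding (sub a b edge-ab G′) = subdivide-pathEmbedding (subdivision-pathEmbedding G′) edge-ab
subdivision-pathEmbedding (iso G′ G′≅G)        = Iso-pathEmbedding (subdivision-pathEmbedding G′) G′≅G

IsLowest : ∀ {n} → (Fin n → ℕ) → Fin n → Set
IsLowest h x = ∀ y → h x ≤ h y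

lowest : ∀ {n} (h : Fin (suc n) → ℕ) → ∃ (IsLowest h)
lowest {zero}  h = zero , λ { zero → ≤-refl }
lowest {suc n} h with lowest (h ∘ suc)
... | m , m-lowest with h zero ≤? h (suc m)
...   | yes h0≤hm = zero  , λ { zero → ≤-refl ; (suc y) → ≤-trans h0≤hm (m-lowest y) }
...   | no  h0≰hm = suc m , λ { zero → ℕ.<⇒≤ (≰⇒> h0≰hm) ; (suc y) → m-lowest y }

lowest-consecutive : ∀ {n} {h : Fin n → ℕ} {x y} → IsLowest h x → Consecutive (h x) (h y) → h y ≡ suc (h x)
lowest-consecutive x-lowest (inj₁ hy≡1+hx) = hy≡1+hx
lowest-consecutive {h = h} {y = y} x-lowest (inj₂ hx≡1+hy) = ⊥-elim (1+n≰n (subst (_≤ h y) hx≡1+hy (x-lowest y)))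

record PathTrigraph {n} (T : Trigraph n) : Set where
  field
    embedding : PathEmbedding (underlying T)
  open PathEmbedding embedding public
  field
    red-lowest : ∀ i j → isRed (T i j) ≡ true → IsLowest height i ⊎ IsLowest height j

isRed⇒isEdge : ∀ {c} → isRed c ≡ true → isEdge c ≡ true
isRed⇒isEdge {red} _ = refl

pathTrigraph-redDeg≤1 : ∀ {n} {T : Trigraph n} → PathTrigraph T → MaxRedDeg≤ 1 T
pathTrigraph-redDeg≤1 {T = T} P i = ≤-trans (≤-reflexive (redDeg≡count T i)) (count-≤1 (isRedNeighbour T i) unique)
  where
  open PathTrigraph P
  is-red : ∀ j → isRedNeighbour T i j ≡ true → isRed (T i j) ≡ true
  is-red j red-j with does (j ≟ i)
  ... | false = red-j
  above-lowest : IsLowest height i → ∀ j → isRedNeighbour T i j ≡ true → height j ≡ suc (height i)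
  above-lowest i-lowest j red-j = lowest-consecutive i-lowest (height-consecutive i j (isRed⇒isEdge (is-red j red-j)))
  unique-above-lowest : IsLowest height i →
    ∀ j l → isRedNeighbour T i j ≡ true → isRedNeighbour T i l ≡ true → j ≡ l
  unique-above-lowest i-lowest j l red-j red-l =
    height-injective j l (trans (above-lowest i-lowest j red-j) (sym (above-lowest i-lowest l red-l)))
  unique : ∀ j l → isRedNeighbour T i j ≡ true → isRedNeighbour T i l ≡ true → j ≡ l
  unique j l red-j red-l with red-lowest i j (is-red j red-j) | red-lowest i l (is-red l red-l)
  ... | inj₁ i-lowest | _             = unique-above-lowest i-lowest j l red-j red-l
  ... | _             | inj₁ i-lowest = unique-above-lowest i-lowest j l red-j red-l
  ... | inj₂ j-lowest | inj₂ l-lowest = height-injective j l (≤-antisym (j-lowest l) (l-lowest j))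

module _ {n} {G : Graph (suc n)} (P : PathEmbedding G) {b : Fin (suc n)} {a₀ : Fin n}
         (b-lowest : IsLowest (PathEmbedding.height P) b)
         (a₀-lowest : IsLowest (PathEmbedding.height P ∘ punchIn b) a₀) where
  open PathEmbedding P

  lowest-neighbour : ∀ x → Consecutive (height b) (height x) → x ≡ punchIn b a₀
  lowest-neighbour x consecutive = sym (height-injective _ x (≤-antisym ha≤hx hx≤ha))
    where
    hx≡1+hb : height x ≡ suc (height b)
    hx≡1+hb = lowest-consecutive b-lowest consecutive
    b≢x : ¬ b ≡ x
    b≢x refl = 1+n≢n (sym hx≡1+hb)
    ha≤hx : height (punchIn b a₀) ≤ height x
    ha≤hx = subst (λ z → height (punchIn b a₀) ≤ height z) (punchIn-punchOut b≢x) (a₀-lowest _)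
    hx≤ha : height x ≤ height (punchIn b a₀)
    hx≤ha = subst (_≤ height (punchIn b a₀)) (sym hx≡1+hb)
      (ℕ.≤∧≢⇒< (b-lowest _) (λ hb≡ha → punchInᵢ≢i b a₀ (sym (height-injective b _ hb≡ha))))

  contractGraph-pathEmbedding : PathEmbedding (contractGraph G (punchIn b a₀) b)
  contractGraph-pathEmbedding = record
    { height             = height ∘ punchIn b
    ; height-injective   = λ i j hi≡hj → punchIn-injective b i j (height-injective _ _ hi≡hj)
    ; height-consecutive = consecutive′
    }
    where
    consecutive′ : ∀ i j → contractGraph G (punchIn b a₀) b i j ≡ true →
      Consecutive (height (punchIn b i)) (height (punchIn b j))
    consecutive′ i j edge with punchIn b i ≟ punchIn b a₀ | punchIn b j ≟ punchIn b a₀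
    ... | yes pi≡a | no pj≢a with ∨-true (G (punchIn b a₀) (punchIn b j)) edge
    ...   | inj₁ edge′ = subst (λ z → Consecutive (height z) _) (sym pi≡a) (height-consecutive _ _ edge′)
    ...   | inj₂ edge′ = ⊥-elim (pj≢a (lowest-neighbour _ (height-consecutive _ _ edge′)))
    consecutive′ i j edge | no pi≢a | yes pj≡a with ∨-true (G (punchIn b i) (punchIn b a₀)) edge
    ...   | inj₁ edge′ = subst (λ z → Consecutive _ (height z)) (sym pj≡a) (height-consecutive _ _ edge′)
    ...   | inj₂ edge′ = ⊥-elim (pi≢a (lowest-neighbour _ (Consecutive-sym (height-consecutive _ _ edge′))))
    consecutive′ i j edge | no _ | no _ = height-consecutive _ _ edge

contract-pathTrigraph : ∀ {n} {T : Trigraph (suc n)} (P : PathTrigraph T) {b a₀} →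
  IsLowest (PathTrigraph.height P) b → IsLowest (PathTrigraph.height P ∘ punchIn b) a₀ →
  PathTrigraph (contract T (punchIn b a₀) b)
contract-pathTrigraph {T = T} P {b} {a₀} b-lowest a₀-lowest = record
  { embedding  = Iso-pathEmbedding (contractGraph-pathEmbedding embedding b-lowest a₀-lowest)
                                   (≗⇒Iso (underlying-contract T (punchIn b a₀) b))
  ; red-lowest = red-lowest′
  }
  where
  open PathTrigraph P
  merged-lowest : ∀ i → punchIn b i ≡ punchIn b a₀ → IsLowest (height ∘ punchIn b) i
  merged-lowest i pi≡a l = subst (λ z → height z ≤ height (punchIn b l)) (sym pi≡a) (a₀-lowest l)
  not-lowest : ∀ i → ¬ IsLowest height (punchIn b i)
  not-lowest i pi-lowest = punchInᵢ≢i b i (height-injective _ _ (≤-antisym (pi-lowest b) (b-lowest _)))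
  -- Red edges are created only at the merged vertex, which is the new lowest one.
  red-lowest′ : ∀ i j → isRed (contract T (punchIn b a₀) b i j) ≡ true →
    IsLowest (height ∘ punchIn b) i ⊎ IsLowest (height ∘ punchIn b) j
  red-lowest′ i j red-ij with punchIn b i ≟ punchIn b a₀ | punchIn b j ≟ punchIn b a₀
  ... | yes pi≡a | _        = inj₁ (merged-lowest i pi≡a)
  ... | no _     | yes pj≡a = inj₂ (merged-lowest j pj≡a)
  ... | no _     | no _     with red-lowest _ _ red-ij
  ...   | inj₁ pi-lowest = ⊥-elim (not-lowest i pi-lowest)
  ...   | inj₂ pj-lowest = ⊥-elim (not-lowest j pj-lowest)

pathTrigraph-contractible : ∀ n (T : Trigraph (suc n)) → PathTrigraph T → Contractible 1 (suc n) T
pathTrigraph-contractible zero    T P = done T (pathTrigraph-redDeg≤1 P)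
pathTrigraph-contractible (suc n) T P =
  let b  , b-lowest  = lowest height
      a₀ , a₀-lowest = lowest (height ∘ punchIn b)
  in step T (pathTrigraph-redDeg≤1 P) (punchIn b a₀) b (punchInᵢ≢i b a₀)
       (pathTrigraph-contractible n _ (contract-pathTrigraph P b-lowest a₀-lowest))
  where open PathTrigraph P

toTrigraph-pathTrigraph : ∀ {n} {G : Graph n} → PathEmbedding G → PathTrigraph (toTrigraph G)
toTrigraph-pathTrigraph {G = G} P = record
  { embedding  = Iso-pathEmbedding P (≗⇒Iso (underlying-toTrigraph G))
  ; red-lowest = λ i j red-ij → ⊥-elim (no-red i j red-ij)
  }
  where
  no-red : ∀ i j → ¬ isRed (toTrigraph G i j) ≡ true
  no-red i j with G i j
  ... | true  = λ ()
  ... | false = λ ()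

subdivision-size : ∀ {d n} {G : Graph n} → SubdivOfK d n G → d ≤ n
subdivision-size base           = ≤-refl
subdivision-size (sub _ _ _ G′) = ≤-trans (subdivision-size G′) (n≤1+n _)
subdivision-size (iso G′ _)     = subdivision-size G′

lemma2 : (d : ℕ) → 2 ≤ d → (n : ℕ) → (G : Graph n) → SubdivOfK d n G → TwwAtMost (d ∸ 1) G
lemma2 d 2≤d zero G G-sub with ≤-trans 2≤d (subdivision-size G-sub)
... | ()
lemma2 (suc (suc zero)) _ (suc n) G G-sub =
  pathTrigraph-contractible n (toTrigraph G) (toTrigraph-pathTrigraph (subdivision-pathEmbedding G-sub))
lemma2 (suc (suc (suc k))) _ (suc n) G G-sub =
  fewBranch-contractible n (toTrigraph G)
    (Iso-fewBranch (subdivision-fewBranch (s≤s (s≤s z≤n)) G-sub) (≗⇒Iso (underlying-toTrigraph G)))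
lemma2 (suc zero) (s≤s ()) _ _ _
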